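{- Let $(R,+,\cdot,0,1)$ be a semiring and let $C(R)$ be the set of its complemented and commuting elements. Then $C(R)$, with the operations $r\vee s=r+r's$, $r\wedge s=rs$, complementation $r\mapsto r'$, and constants $0,1$, is a Boolean algebra.
   Context: A semiring is an algebra $(R,+,\cdot,0,1)$ with $(R,+,0)$ a commutative monoid, $(R,\cdot,1)$ a monoid (not necessarily commutative), $x0=0x=0$, and two-sided distributivity of $\cdot$ over $+$. An element $r\in R$ is complemented if there exists $s\in R$ with $r+s=1$ and $rs=0$; such $s$ is unique and is denoted $r'$. An element $r$ is commuting if $rt=tr$ for all $t\in R$. -}

module Defs where

open import Level using (_⊔_)
open import Algebra.Bundles using (Semiring)
open import Algebra.Core using (Op₁; Op₂)
open import Algebra.Lattice.Structures using (IsBooleanAlgebra)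
open import Data.Product using (Σ; _×_; proj₁; proj₂)

module _ {c ℓ} (R : Semiring c ℓ) where
  open Semiring R

  IsComplementOf : Carrier → Carrier → Set ℓ
  IsComplementOf r s = (r + s ≈ 1#) × (r * s ≈ 0#)

  Complemented : Carrier → Set (c ⊔ ℓ)
  Complemented r = Σ Carrier (IsComplementOf r)

  Commuting : Carrier → Set (c ⊔ ℓ)
  Commuting r = ∀ t → r * t ≈ t * r

  CR : Set (c ⊔ ℓ)
  CR = Σ Carrier λ r → Complemented r × Commuting r

  elem : CR → Carrier
  elem = proj₁

  -- r' (the complement; unique up to ≈, as the paper notes)
  comp : CR → Carrier
  comp x = proj₁ (proj₁ (proj₂ x))

  _≈C_ : CR → CR → Set ℓ
  x ≈C y = elem x ≈ elem y

  record BooleanAlgebraOnC : Set (c ⊔ ℓ) where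
    field
      _∨_ : Op₂ CR
      _∧_ : Op₂ CR
      ¬_  : Op₁ CR
      ⊤   : CR
      ⊥   : CR
      ∨-def : ∀ x y → elem (x ∨ y) ≈ elem x + comp x * elem y
      ∧-def : ∀ x y → elem (x ∧ y) ≈ elem x * elem y
      ¬-def : ∀ x → elem (¬ x) ≈ comp x
      ⊤-def : elem ⊤ ≈ 1#
      ⊥-def : elem ⊥ ≈ 0#
      isBooleanAlgebra : IsBooleanAlgebra _≈C_ _∨_ _∧_ ¬_ ⊤ ⊥

module Submission where

-- Consequently all elements of C(R)
-- and their complements are central idempotents, and every product that
-- contains some x together with x' vanishes.  With these facts each
-- operation is shown to land in C(R) (by exhibiting the complement of
-- x ∧ y as x' + x y' and that of x ∨ y as x' y'), and each Boolean
-- algebra law becomes a short computation in R.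

open import Defs
open import Algebra.Bundles using (Semiring)
open import Algebra.Lattice.Structures using (IsLattice)
open import Algebra.Lattice.Structures.Biased
  using (isDistributiveLatticeʳʲᵐ; isBooleanAlgebraʳ)
open import Data.Product using (_,_; proj₁; proj₂)
open import Level using (_⊔_)
open import Relation.Binary.Bundles using (Setoid)
import Algebra.Consequences.Setoid as Consequences
import Relation.Binary.Reasoning.Setoid as SetoidReasoning

module BooleanCentre {c ℓ} (R : Semiring c ℓ) where
  open Semiring R
  open SetoidReasoning setoid

  0-commuting : Commuting R 0#
  0-commuting t = trans (zeroˡ t) (sym (zeroʳ t))

  1-commuting : Commuting R 1#
  1-commuting t = trans (*-identityˡ t) (sym (*-identityʳ t))

  +-commuting : ∀ {a b} → Commuting R a → Commuting R b → Commuting R (a + b)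
  +-commuting {a} {b} ca cb t = begin
    (a + b) * t    ≈⟨ distribʳ t a b ⟩
    a * t + b * t  ≈⟨ +-cong (ca t) (cb t) ⟩
    t * a + t * b  ≈⟨ distribˡ t a b ⟨
    t * (a + b)    ∎

  *-commuting : ∀ {a b} → Commuting R a → Commuting R b → Commuting R (a * b)
  *-commuting {a} {b} ca cb t = begin
    (a * b) * t  ≈⟨ *-assoc a b t ⟩
    a * (b * t)  ≈⟨ *-congˡ (cb t) ⟩
    a * (t * b)  ≈⟨ *-assoc a t b ⟨
    (a * t) * b  ≈⟨ *-congʳ (ca t) ⟩
    (t * a) * b  ≈⟨ *-assoc t a b ⟩
    t * (a * b)  ∎

  annihilateˡ : ∀ {a b} c → a * b ≈ 0# → a * (b * c) ≈ 0#
  annihilateˡ {a} {b} c ab≈0 = begin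
    a * (b * c)  ≈⟨ *-assoc a b c ⟨
    (a * b) * c  ≈⟨ *-congʳ ab≈0 ⟩
    0# * c       ≈⟨ zeroˡ c ⟩
    0#           ∎

  -- The middle factors of a fourfold product may be swapped when one of
  -- them commutes; this brings x and x' (or y and y') next to each other.
  medial : ∀ {b} a c d → Commuting R b → (a * b) * (c * d) ≈ (a * c) * (b * d)
  medial {b} a c d cb = begin
    (a * b) * (c * d)  ≈⟨ *-assoc a b (c * d) ⟩
    a * (b * (c * d))  ≈⟨ *-congˡ (*-assoc b c d) ⟨
    a * ((b * c) * d)  ≈⟨ *-congˡ (*-congʳ (cb c)) ⟩
    a * ((c * b) * d)  ≈⟨ *-congˡ (*-assoc c b d) ⟩
    a * (c * (b * d))  ≈⟨ *-assoc a c (b * d) ⟨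
    (a * c) * (b * d)  ∎

  split : ∀ a {b b'} → b + b' ≈ 1# → a ≈ a * b + a * b'
  split a {b} {b'} b+b'≈1 = begin
    a                  ≈⟨ *-identityʳ a ⟨
    a * 1#             ≈⟨ *-congˡ b+b'≈1 ⟨
    a * (b + b')       ≈⟨ distribˡ a b b' ⟩
    a * b + a * b'     ∎

  complemented-idempotent : ∀ {a b} → a + b ≈ 1# → a * b ≈ 0# → a * a ≈ a
  complemented-idempotent {a} {b} a+b≈1 ab≈0 = begin
    a * a           ≈⟨ +-identityʳ (a * a) ⟨
    a * a + 0#      ≈⟨ +-congˡ ab≈0 ⟨
    a * a + a * b   ≈⟨ split a a+b≈1 ⟨
    a               ∎

  -- Complements are unique: a right complement b and a left complement d
  -- of a coincide (both equal d b).
  complement-unique : ∀ {a b d} → a + b ≈ 1# → a * b ≈ 0# →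
                      a + d ≈ 1# → d * a ≈ 0# → b ≈ d
  complement-unique {a} {b} {d} a+b≈1 ab≈0 a+d≈1 da≈0 = begin
    b               ≈⟨ *-identityˡ b ⟨
    1# * b          ≈⟨ *-congʳ a+d≈1 ⟨
    (a + d) * b     ≈⟨ distribʳ b a d ⟩
    a * b + d * b   ≈⟨ +-congʳ ab≈0 ⟩
    0# + d * b      ≈⟨ +-congʳ da≈0 ⟨
    d * a + d * b   ≈⟨ split d a+b≈1 ⟨
    d               ∎

  -- The complement of a commuting element commutes: b t and t b both
  -- equal b t b, since the cross terms b t a = b a t and a t b = t a b
  -- vanish.
  complement-commuting : ∀ {a b} → Commuting R a → a + b ≈ 1# → a * b ≈ 0# →
                         Commuting R b
  complement-commuting {a} {b} ca a+b≈1 ab≈0 t = trans bt≈btb (sym tb≈btb)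
    where
    ba≈0 : b * a ≈ 0#
    ba≈0 = trans (sym (ca b)) ab≈0

    bt≈btb : b * t ≈ (b * t) * b
    bt≈btb = begin
      b * t                        ≈⟨ split (b * t) a+b≈1 ⟩
      (b * t) * a + (b * t) * b    ≈⟨ +-congʳ (*-assoc b t a) ⟩
      b * (t * a) + (b * t) * b    ≈⟨ +-congʳ (*-congˡ (ca t)) ⟨
      b * (a * t) + (b * t) * b    ≈⟨ +-congʳ (annihilateˡ t ba≈0) ⟩
      0# + (b * t) * b             ≈⟨ +-identityˡ _ ⟩
      (b * t) * b                  ∎

    tb≈btb : t * b ≈ (b * t) * b
    tb≈btb = begin
      t * b                        ≈⟨ *-identityˡ (t * b) ⟨
      1# * (t * b)                 ≈⟨ *-congʳ a+b≈1 ⟨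
      (a + b) * (t * b)            ≈⟨ distribʳ (t * b) a b ⟩
      a * (t * b) + b * (t * b)    ≈⟨ +-cong (*-assoc a t b) (*-assoc b t b) ⟨
      (a * t) * b + (b * t) * b    ≈⟨ +-congʳ (*-congʳ (ca t)) ⟩
      (t * a) * b + (b * t) * b    ≈⟨ +-congʳ (*-assoc t a b) ⟩
      t * (a * b) + (b * t) * b    ≈⟨ +-congʳ (*-congˡ ab≈0) ⟩
      t * 0# + (b * t) * b         ≈⟨ +-congʳ (zeroʳ t) ⟩
      0# + (b * t) * b             ≈⟨ +-identityˡ _ ⟩
      (b * t) * b                  ∎

  ⟦_⟧ : CR R → Carrier
  ⟦_⟧ = elem R

  _′ : CR R → Carrier
  _′ = comp R

  infix 10 _′

  commuting : (x : CR R) → Commuting R ⟦ x ⟧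
  commuting x = proj₂ (proj₂ x)

  sum-one : (x : CR R) → ⟦ x ⟧ + x ′ ≈ 1#
  sum-one x = proj₁ (proj₂ (proj₁ (proj₂ x)))

  product-zero : (x : CR R) → ⟦ x ⟧ * x ′ ≈ 0#
  product-zero x = proj₂ (proj₂ (proj₁ (proj₂ x)))

  ′-commuting : (x : CR R) → Commuting R (x ′)
  ′-commuting x = complement-commuting (commuting x) (sum-one x) (product-zero x)

  ′-product-zero : (x : CR R) → x ′ * ⟦ x ⟧ ≈ 0#
  ′-product-zero x = trans (sym (commuting x (x ′))) (product-zero x)

  idempotent : (x : CR R) → ⟦ x ⟧ * ⟦ x ⟧ ≈ ⟦ x ⟧
  idempotent x = complemented-idempotent (sum-one x) (product-zero x)

  ′-idempotent : (x : CR R) → x ′ * x ′ ≈ x ′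
  ′-idempotent x = complemented-idempotent
    (trans (+-comm (x ′) ⟦ x ⟧) (sum-one x)) (′-product-zero x)

  ′-cong : ∀ {x y} → ⟦ x ⟧ ≈ ⟦ y ⟧ → x ′ ≈ y ′
  ′-cong {x} {y} x≈y = complement-unique (sum-one x) (product-zero x)
    (trans (+-congʳ x≈y) (sum-one y))
    (trans (*-congˡ x≈y) (′-product-zero y))

  mkCR : ∀ a b → Commuting R a → a + b ≈ 1# → a * b ≈ 0# → CR R
  mkCR a b ca a+b≈1 ab≈0 = a , (b , a+b≈1 , ab≈0) , ca

  _∧_ : CR R → CR R → CR R
  x ∧ y = mkCR (⟦ x ⟧ * ⟦ y ⟧) (x ′ + ⟦ x ⟧ * y ′)
    (*-commuting (commuting x) (commuting y)) sum≈1 product≈0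
    where
    sum≈1 : ⟦ x ⟧ * ⟦ y ⟧ + (x ′ + ⟦ x ⟧ * y ′) ≈ 1#
    sum≈1 = begin
      ⟦ x ⟧ * ⟦ y ⟧ + (x ′ + ⟦ x ⟧ * y ′)    ≈⟨ +-congˡ (+-comm _ _) ⟩
      ⟦ x ⟧ * ⟦ y ⟧ + (⟦ x ⟧ * y ′ + x ′)    ≈⟨ +-assoc _ _ _ ⟨
      (⟦ x ⟧ * ⟦ y ⟧ + ⟦ x ⟧ * y ′) + x ′    ≈⟨ +-congʳ (split ⟦ x ⟧ (sum-one y)) ⟨
      ⟦ x ⟧ + x ′                            ≈⟨ sum-one x ⟩
      1#                                     ∎

    product≈0 : (⟦ x ⟧ * ⟦ y ⟧) * (x ′ + ⟦ x ⟧ * y ′) ≈ 0#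
    product≈0 = begin
      (⟦ x ⟧ * ⟦ y ⟧) * (x ′ + ⟦ x ⟧ * y ′)
        ≈⟨ distribˡ _ _ _ ⟩
      (⟦ x ⟧ * ⟦ y ⟧) * x ′ + (⟦ x ⟧ * ⟦ y ⟧) * (⟦ x ⟧ * y ′)
        ≈⟨ +-cong (sym (′-commuting x _)) (medial ⟦ x ⟧ ⟦ x ⟧ (y ′) (commuting y)) ⟩
      x ′ * (⟦ x ⟧ * ⟦ y ⟧) + (⟦ x ⟧ * ⟦ x ⟧) * (⟦ y ⟧ * y ′)
        ≈⟨ +-cong (annihilateˡ ⟦ y ⟧ (′-product-zero x)) (*-congˡ (product-zero y)) ⟩
      0# + (⟦ x ⟧ * ⟦ x ⟧) * 0#
        ≈⟨ +-identityˡ _ ⟩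
      (⟦ x ⟧ * ⟦ x ⟧) * 0#
        ≈⟨ zeroʳ _ ⟩
      0# ∎

  _∨_ : CR R → CR R → CR R
  x ∨ y = mkCR (⟦ x ⟧ + x ′ * ⟦ y ⟧) (x ′ * y ′)
    (+-commuting (commuting x) (*-commuting (′-commuting x) (commuting y)))
    sum≈1 product≈0
    where
    sum≈1 : (⟦ x ⟧ + x ′ * ⟦ y ⟧) + x ′ * y ′ ≈ 1#
    sum≈1 = begin
      (⟦ x ⟧ + x ′ * ⟦ y ⟧) + x ′ * y ′   ≈⟨ +-assoc _ _ _ ⟩
      ⟦ x ⟧ + (x ′ * ⟦ y ⟧ + x ′ * y ′)   ≈⟨ +-congˡ (split (x ′) (sum-one y)) ⟨
      ⟦ x ⟧ + x ′                         ≈⟨ sum-one x ⟩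
      1#                                  ∎

    product≈0 : (⟦ x ⟧ + x ′ * ⟦ y ⟧) * (x ′ * y ′) ≈ 0#
    product≈0 = begin
      (⟦ x ⟧ + x ′ * ⟦ y ⟧) * (x ′ * y ′)
        ≈⟨ distribʳ _ _ _ ⟩
      ⟦ x ⟧ * (x ′ * y ′) + (x ′ * ⟦ y ⟧) * (x ′ * y ′)
        ≈⟨ +-cong (annihilateˡ (y ′) (product-zero x)) (medial (x ′) (x ′) (y ′) (commuting y)) ⟩
      0# + (x ′ * x ′) * (⟦ y ⟧ * y ′)
        ≈⟨ +-congˡ (*-congˡ (product-zero y)) ⟩
      0# + (x ′ * x ′) * 0#
        ≈⟨ +-identityˡ _ ⟩
      (x ′ * x ′) * 0#
        ≈⟨ zeroʳ _ ⟩
      0# ∎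

  ¬_ : CR R → CR R
  ¬ x = mkCR (x ′) ⟦ x ⟧ (′-commuting x)
    (trans (+-comm (x ′) ⟦ x ⟧) (sum-one x)) (′-product-zero x)

  ⊤ : CR R
  ⊤ = mkCR 1# 0# 1-commuting (+-identityʳ 1#) (zeroʳ 1#)

  ⊥ : CR R
  ⊥ = mkCR 0# 1# 0-commuting (+-identityˡ 1#) (zeroˡ 1#)

  ∨-cong : ∀ {x x₂ y y₂} → ⟦ x ⟧ ≈ ⟦ x₂ ⟧ → ⟦ y ⟧ ≈ ⟦ y₂ ⟧ → ⟦ x ∨ y ⟧ ≈ ⟦ x₂ ∨ y₂ ⟧
  ∨-cong {x} {x₂} x≈x₂ y≈y₂ = +-cong x≈x₂ (*-cong (′-cong {x} {x₂} x≈x₂) y≈y₂)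

  ∨-assoc : ∀ x y z → ⟦ (x ∨ y) ∨ z ⟧ ≈ ⟦ x ∨ (y ∨ z) ⟧
  ∨-assoc x y z = begin
    (⟦ x ⟧ + x ′ * ⟦ y ⟧) + (x ′ * y ′) * ⟦ z ⟧  ≈⟨ +-assoc _ _ _ ⟩
    ⟦ x ⟧ + (x ′ * ⟦ y ⟧ + (x ′ * y ′) * ⟦ z ⟧)  ≈⟨ +-congˡ (+-congˡ (*-assoc _ _ _)) ⟩
    ⟦ x ⟧ + (x ′ * ⟦ y ⟧ + x ′ * (y ′ * ⟦ z ⟧))  ≈⟨ +-congˡ (distribˡ _ _ _) ⟨
    ⟦ x ⟧ + x ′ * (⟦ y ⟧ + y ′ * ⟦ z ⟧)          ∎

  -- x ∨ y = x y + x y' + x' y, a form symmetric in x and y.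
  ∨-comm : ∀ x y → ⟦ x ∨ y ⟧ ≈ ⟦ y ∨ x ⟧
  ∨-comm x y = begin
    ⟦ x ⟧ + x ′ * ⟦ y ⟧
      ≈⟨ +-congʳ (split ⟦ x ⟧ (sum-one y)) ⟩
    (⟦ x ⟧ * ⟦ y ⟧ + ⟦ x ⟧ * y ′) + x ′ * ⟦ y ⟧
      ≈⟨ +-assoc _ _ _ ⟩
    ⟦ x ⟧ * ⟦ y ⟧ + (⟦ x ⟧ * y ′ + x ′ * ⟦ y ⟧)
      ≈⟨ +-congˡ (+-comm _ _) ⟩
    ⟦ x ⟧ * ⟦ y ⟧ + (x ′ * ⟦ y ⟧ + ⟦ x ⟧ * y ′)
      ≈⟨ +-assoc _ _ _ ⟨
    (⟦ x ⟧ * ⟦ y ⟧ + x ′ * ⟦ y ⟧) + ⟦ x ⟧ * y ′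
      ≈⟨ +-cong (+-cong (commuting x _) (sym (commuting y _))) (commuting x _) ⟩
    (⟦ y ⟧ * ⟦ x ⟧ + ⟦ y ⟧ * x ′) + y ′ * ⟦ x ⟧
      ≈⟨ +-congʳ (split ⟦ y ⟧ (sum-one x)) ⟨
    ⟦ y ⟧ + y ′ * ⟦ x ⟧
      ∎

  ∨-absorbs-∧ : ∀ x y → ⟦ x ∨ (x ∧ y) ⟧ ≈ ⟦ x ⟧
  ∨-absorbs-∧ x y = begin
    ⟦ x ⟧ + x ′ * (⟦ x ⟧ * ⟦ y ⟧)  ≈⟨ +-congˡ (annihilateˡ ⟦ y ⟧ (′-product-zero x)) ⟩
    ⟦ x ⟧ + 0#                     ≈⟨ +-identityʳ _ ⟩
    ⟦ x ⟧                          ∎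

  ∧-absorbs-∨ : ∀ x y → ⟦ x ∧ (x ∨ y) ⟧ ≈ ⟦ x ⟧
  ∧-absorbs-∨ x y = begin
    ⟦ x ⟧ * (⟦ x ⟧ + x ′ * ⟦ y ⟧)          ≈⟨ distribˡ _ _ _ ⟩
    ⟦ x ⟧ * ⟦ x ⟧ + ⟦ x ⟧ * (x ′ * ⟦ y ⟧)  ≈⟨ +-cong (idempotent x) (annihilateˡ ⟦ y ⟧ (product-zero x)) ⟩
    ⟦ x ⟧ + 0#                             ≈⟨ +-identityʳ _ ⟩
    ⟦ x ⟧                                  ∎

  -- (x + x'y)(x + x'z) = x + x'yz: the cross terms vanish and x, x' are
  -- idempotent.
  ∨-distribˡ-∧ : ∀ x y z → ⟦ x ∨ (y ∧ z) ⟧ ≈ ⟦ (x ∨ y) ∧ (x ∨ z) ⟧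
  ∨-distribˡ-∧ x y z = sym (begin
    (⟦ x ⟧ + x ′ * ⟦ y ⟧) * (⟦ x ⟧ + x ′ * ⟦ z ⟧)
      ≈⟨ distribˡ _ _ _ ⟩
    (⟦ x ⟧ + x ′ * ⟦ y ⟧) * ⟦ x ⟧ + (⟦ x ⟧ + x ′ * ⟦ y ⟧) * (x ′ * ⟦ z ⟧)
      ≈⟨ +-cong (distribʳ _ _ _) (distribʳ _ _ _) ⟩
    (⟦ x ⟧ * ⟦ x ⟧ + (x ′ * ⟦ y ⟧) * ⟦ x ⟧)
      + (⟦ x ⟧ * (x ′ * ⟦ z ⟧) + (x ′ * ⟦ y ⟧) * (x ′ * ⟦ z ⟧))
      ≈⟨ +-cong (+-congˡ (sym (commuting x _))) (+-congʳ (annihilateˡ ⟦ z ⟧ (product-zero x))) ⟩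
    (⟦ x ⟧ * ⟦ x ⟧ + ⟦ x ⟧ * (x ′ * ⟦ y ⟧))
      + (0# + (x ′ * ⟦ y ⟧) * (x ′ * ⟦ z ⟧))
      ≈⟨ +-cong (+-cong (idempotent x) (annihilateˡ ⟦ y ⟧ (product-zero x)))
                (+-identityˡ _) ⟩
    (⟦ x ⟧ + 0#) + (x ′ * ⟦ y ⟧) * (x ′ * ⟦ z ⟧)
      ≈⟨ +-cong (+-identityʳ _) (medial (x ′) (x ′) ⟦ z ⟧ (commuting y)) ⟩
    ⟦ x ⟧ + (x ′ * x ′) * (⟦ y ⟧ * ⟦ z ⟧)
      ≈⟨ +-congˡ (*-congʳ (′-idempotent x)) ⟩
    ⟦ x ⟧ + x ′ * (⟦ y ⟧ * ⟦ z ⟧)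
      ∎)

  ∨-complementʳ : ∀ x → ⟦ x ∨ (¬ x) ⟧ ≈ ⟦ ⊤ ⟧
  ∨-complementʳ x = trans (+-congˡ (′-idempotent x)) (sum-one x)

  ∧-complementʳ : ∀ x → ⟦ x ∧ (¬ x) ⟧ ≈ ⟦ ⊥ ⟧
  ∧-complementʳ = product-zero

  ¬-cong : ∀ {x y} → ⟦ x ⟧ ≈ ⟦ y ⟧ → ⟦ ¬ x ⟧ ≈ ⟦ ¬ y ⟧
  ¬-cong {x} {y} = ′-cong {x} {y}

  CR-setoid : Setoid (c ⊔ ℓ) ℓ
  CR-setoid = record { Carrier = CR R ; _≈_ = _≈C_ R
                     ; isEquivalence = record { refl = refl ; sym = sym ; trans = trans } }

  isLattice : IsLattice (_≈C_ R) _∨_ _∧_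
  isLattice = record
    { isEquivalence = Setoid.isEquivalence CR-setoid
    ; ∨-comm        = ∨-comm
    ; ∨-assoc       = ∨-assoc
    ; ∨-cong        = λ {x} {x₂} {y} {y₂} → ∨-cong {x} {x₂} {y} {y₂}
    ; ∧-comm        = λ x y → commuting x ⟦ y ⟧
    ; ∧-assoc       = λ x y z → *-assoc ⟦ x ⟧ ⟦ y ⟧ ⟦ z ⟧
    ; ∧-cong        = *-cong
    ; absorptive    = ∨-absorbs-∧ , ∧-absorbs-∨
    }

  booleanAlgebra : BooleanAlgebraOnC R
  booleanAlgebra = record
    { _∨_ = _∨_ ; _∧_ = _∧_ ; ¬_ = ¬_ ; ⊤ = ⊤ ; ⊥ = ⊥
    ; ∨-def = λ _ _ → refl ; ∧-def = λ _ _ → refl ; ¬-def = λ _ → refl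
    ; ⊤-def = refl ; ⊥-def = refl
    ; isBooleanAlgebra = isBooleanAlgebraʳ (record
      { isDistributiveLattice = isDistributiveLatticeʳʲᵐ (record
        { isLattice    = isLattice
        ; ∨-distribʳ-∧ = Consequences.comm∧distrˡ⇒distrʳ CR-setoid
                           {_∨_} {_∧_} *-cong ∨-comm ∨-distribˡ-∧
        })
      ; ∨-complementʳ = ∨-complementʳ
      ; ∧-complementʳ = ∧-complementʳ
      ; ¬-cong        = λ {x} {y} → ¬-cong {x} {y}
      })
    }

lemma5p6 : ∀ {c ℓ} (R : Semiring c ℓ) → BooleanAlgebraOnC R
lemma5p6 R = BooleanCentre.booleanAlgebra R
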